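{- Let $n,t,r$ be nonnegative integers with $t+r\le n-2$. Then (i) $c_{n, t+r}/c_{n, t} \le 2^r$; (ii) if $t \ge 2n/3$, then $c_{n, t+r}/c_{n, t} \le (e/3)^r$; (iii) if $n/2 \le t < 2n/3$, then $c_{n, t+r}/c_{n, t} \le (9/8)^r$; (iv) $c_{n, t+r}/c_{n, t} \ge 1/n^r$.
   Context: For integers $0\le s\le n-1$, $c_{n,s}$ denotes the maximum of the product $q_1 q_2\cdots q_{n-s}$ over all $(n-s)$-tuples of positive integers $q_1,\dots,q_{n-s}$ with $q_1+\dots+q_{n-s}=n$. -}

module Defs where

open import Data.Nat using (ℕ; zero; suc; _+_; _*_; _∸_; _^_; _≤_; _<_; _⊔_)
open import Data.List using (List; []; _∷_; map; concatMap; upTo; foldr)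
open import Data.Nat.ListAction using (product)

compositions : ℕ → ℕ → List (List ℕ)
compositions zero    zero    = [] ∷ []
compositions (suc _) zero    = []
compositions n       (suc k) =
  concatMap (λ q → map (q ∷_) (compositions (n ∸ q) k)) (map suc (upTo n))

maxList : List ℕ → ℕ
maxList = foldr _⊔_ 0

-- c n s = c_{n,s} : the maximum of q₁⋯q_{n-s} over all (n-s)-tuples of
-- positive integers summing to n  (intended for 0 ≤ s ≤ n-1).
c : ℕ → ℕ → ℕ
c n s = maxList (map product (compositions n (n ∸ s)))

-- For natural numbers a, b, r:  "a ≤ eʳ · b"  (e = Euler's number).
-- Since e = inf_{N ≥ 1} (1 + 1/N)^{N+1}, we have a ≤ eʳ b iff for every
-- N ≥ 1,  a · N^{(N+1)r} ≤ (N+1)^{(N+1)r} · b.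
_≤e^_·_ : ℕ → ℕ → ℕ → Set
a ≤e^ r · b = ∀ (N : ℕ) → 1 ≤ N →
  a * N ^ ((N + 1) * r) ≤ (N + 1) ^ ((N + 1) * r) * b

-- Write maxProduct n k for the largest product of a composition of n into k parts, so that
-- c n s = maxProduct n (n ∸ s).  Each bound telescopes a one-step comparison of maxProduct n k
-- with maxProduct n (k + 1), obtained by a local move on a composition with k parts.
-- Splitting a part q ≥ 2 into 1 and q − 1 costs at most a factor 2.  If n ≥ 3(k + 1), either
-- some part q ≥ 5 splits into 2 and q − 2, gaining at least 6/5, or three parts equal 4 and
-- become four 3s, with 6 · 4³ ≤ 5 · 3⁴.  If n ≥ 2(k + 1), likewise a part q ≥ 4 splits into
-- 2 and q − 2, or two 3s become three 2s, losing at most 9/8.  In the other direction, merging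
-- two parts into one loses at most a factor n.  Finally 5/6 ≤ e/3 as (1 + 1/N)^(N+1) ≥ 5/2.
module Submission where

open import Defs
open import Data.Nat using (ℕ; zero; suc; _+_; _*_; +-rawMagma; _∸_; _^_; _≤_; _<_; z≤n; s≤s; s≤s⁻¹; z<s)
open import Data.Nat.Properties
import Algebra.Properties.CommutativeSemigroup +-commutativeSemigroup as +-CS
import Algebra.Properties.CommutativeSemigroup *-commutativeSemigroup as *-CS
open import Data.Nat.ListAction using (product; sum)
open import Data.Nat.ListAction.Properties using (sum-++; product-++; sum-↭; product-↭)
open import Data.List using (List; []; _∷_; _++_; map; concatMap; upTo; length; replicate)
open import Data.List.Properties using (length-++)
open import Data.List.Relation.Unary.All as All using (All; []; _∷_)
import Data.List.Relation.Unary.All.Properties as AllP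
open import Data.List.Relation.Unary.Any using (here; there)
open import Data.List.Membership.Propositional using (_∈_; find; lose)
open import Data.List.Membership.Propositional.Properties
  using (∈-map⁺; ∈-map⁻; ∈-concatMap⁺; ∈-concatMap⁻; ∈-upTo⁺; ∈-upTo⁻)
open import Data.List.Relation.Binary.Permutation.Propositional
  using (_↭_; ↭-refl; ↭-prep; ↭-swap; ↭-sym; ↭-trans)
open import Data.List.Relation.Binary.Permutation.Propositional.Properties
  using (↭-length; All-resp-↭; shift)
open import Data.Product using (_×_; _,_; ∃; ∃₂)
open import Algebra.Definitions.RawMagma +-rawMagma using (_,_)
open import Data.Sum using (_⊎_; inj₁; inj₂)
import Data.Sum as Sum
open import Relation.Binary.Definitions using (tri<; tri≈; tri>)
open import Relation.Binary.PropositionalEquality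
open import Data.Nat.Tactic.RingSolver using (solve-∀)
open import Function using (_∘_)

^-distribʳ-* : ∀ m n o → (m * n) ^ o ≡ m ^ o * n ^ o
^-distribʳ-* m n zero    = refl
^-distribʳ-* m n (suc o) = trans (cong (m * n *_) (^-distribʳ-* m n o)) (*-CS.interchange m n _ _)

1^r*x≡x : ∀ r x → 1 ^ r * x ≡ x
1^r*x≡x r x = trans (cong (_* x) (^-zeroˡ r)) (*-identityˡ x)

[n∸t]*[1+e]≤n : ∀ n t e → e * n ≤ suc e * t → (n ∸ t) * suc e ≤ n
[n∸t]*[1+e]≤n n t e en≤[1+e]t = begin
  (n ∸ t) * suc e         ≡⟨ *-distribʳ-∸ (suc e) n t ⟩
  n * suc e ∸ t * suc e   ≤⟨ m≤n+o⇒m∸n≤o (n * suc e) (t * suc e) (begin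
    n * suc e               ≡⟨ *-suc n e ⟩
    n + n * e               ≤⟨ +-monoʳ-≤ n (subst₂ _≤_ (*-comm e n) (*-comm (suc e) t) en≤[1+e]t) ⟩
    n + t * suc e           ≡⟨ +-comm n _ ⟩
    t * suc e + n           ∎) ⟩
  n                       ∎
  where open ≤-Reasoning

geometric-growth : ∀ (f : ℕ → ℕ) {a b} (P : ℕ → Set) → (∀ {j} → P (suc j) → P j) →
  (∀ {j} → P (suc j) → a * f j ≤ b * f (suc j)) →
  ∀ r {K} → P (r + K) → a ^ r * f K ≤ b ^ r * f (r + K)
geometric-growth f         P P-pred step zero    _ = ≤-refl
geometric-growth f {a} {b} P P-pred step (suc r) {K} P[1+r+K] = begin
  a * a ^ r * f K              ≡⟨ *-assoc a _ _ ⟩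
  a * (a ^ r * f K)            ≤⟨ *-monoʳ-≤ a (geometric-growth f P P-pred step r (P-pred P[1+r+K])) ⟩
  a * (b ^ r * f (r + K))      ≡⟨ *-CS.x∙yz≈y∙xz a (b ^ r) (f (r + K)) ⟩
  b ^ r * (a * f (r + K))      ≤⟨ *-monoʳ-≤ (b ^ r) (step P[1+r+K]) ⟩
  b ^ r * (b * f (suc r + K))  ≡⟨ *-CS.x∙yz≈y∙xz (b ^ r) b (f (suc r + K)) ⟩
  b * (b ^ r * f (suc r + K))  ≡⟨ *-assoc b _ _ ⟨
  b * b ^ r * f (suc r + K)    ∎
  where open ≤-Reasoning

geometric-decay : ∀ (f : ℕ → ℕ) {a b} (P : ℕ → Set) → (∀ {j} → P j → P (suc j)) →
  (∀ {j} → P j → a * f (suc j) ≤ b * f j) →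
  ∀ r {K} → P K → a ^ r * f (r + K) ≤ b ^ r * f K
geometric-decay f         P P-suc step zero    _ = ≤-refl
geometric-decay f {a} {b} P P-suc step (suc r) {K} PK = begin
  a * a ^ r * f (suc r + K)    ≡⟨ *-assoc a _ _ ⟩
  a * (a ^ r * f (suc r + K))  ≡⟨ *-CS.x∙yz≈y∙xz a (a ^ r) (f (suc r + K)) ⟩
  a ^ r * (a * f (suc r + K))  ≤⟨ *-monoʳ-≤ (a ^ r) (step (P-shift r)) ⟩
  a ^ r * (b * f (r + K))      ≡⟨ *-CS.x∙yz≈y∙xz (a ^ r) b (f (r + K)) ⟩
  b * (a ^ r * f (r + K))      ≤⟨ *-monoʳ-≤ b (geometric-decay f P P-suc step r PK) ⟩
  b * (b ^ r * f K)            ≡⟨ *-assoc b _ _ ⟨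
  b * b ^ r * f K              ∎
  where
  open ≤-Reasoning
  P-shift : ∀ i → P (i + K)
  P-shift zero    = PK
  P-shift (suc i) = P-suc (P-shift i)

-- The first three terms of the binomial expansion of (a + 1)ᵐ for m = suc j, times 2a².
binomial-lower-bound : ∀ a j →
  a ^ suc j * (2 * a * a + 2 * suc j * a + suc j * j) ≤ 2 * suc a ^ suc j * (a * a)
binomial-lower-bound a zero    = ≤-reflexive (identity a)
  where
  identity : ∀ a → a * 1 * (2 * a * a + 2 * 1 * a + 1 * 0) ≡ 2 * (suc a * 1) * (a * a)
  identity = solve-∀
binomial-lower-bound a (suc j) = begin
  a * A * (2 * a * a + 2 * suc (suc j) * a + suc (suc j) * suc j)
    ≤⟨ m≤m+n _ (A * (suc j * j)) ⟩
  a * A * (2 * a * a + 2 * suc (suc j) * a + suc (suc j) * suc j) + A * (suc j * j)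
    ≡⟨ recurrence a j A ⟩
  suc a * (A * (2 * a * a + 2 * suc j * a + suc j * j))
    ≤⟨ *-monoʳ-≤ (suc a) (binomial-lower-bound a j) ⟩
  suc a * (2 * B * (a * a))
    ≡⟨ regroup a B ⟩
  2 * (suc a * B) * (a * a) ∎
  where
  open ≤-Reasoning
  A = a ^ suc j
  B = suc a ^ suc j
  recurrence : ∀ a j A →
    a * A * (2 * a * a + 2 * suc (suc j) * a + suc (suc j) * suc j) + A * (suc j * j)
      ≡ suc a * (A * (2 * a * a + 2 * suc j * a + suc j * j))
  recurrence = solve-∀
  regroup : ∀ a B → suc a * (2 * B * (a * a)) ≡ 2 * (suc a * B) * (a * a)
  regroup = solve-∀

5/2≤[1+1/N]^[N+1] : ∀ N → 1 ≤ N → 5 * N ^ (N + 1) ≤ 2 * (N + 1) ^ (N + 1)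
5/2≤[1+1/N]^[N+1] N@(suc _) _ = subst (λ m → 5 * N ^ m ≤ 2 * m ^ m) (+-comm 1 N)
  (*-cancelʳ-≤ (5 * A) (2 * B) (N * N) (begin
    5 * A * (N * N)                                  ≡⟨ regroup A N ⟩
    A * (5 * N * N)                                  ≤⟨ *-monoʳ-≤ A (≤″⇒≤ (3 * N , expand N)) ⟩
    A * (2 * N * N + 2 * suc N * N + suc N * N)      ≤⟨ binomial-lower-bound N N ⟩
    2 * B * (N * N)                                  ∎))
  where
  open ≤-Reasoning
  A = N ^ suc N
  B = suc N ^ suc N
  regroup : ∀ A N → 5 * A * (N * N) ≡ A * (5 * N * N)
  regroup = solve-∀
  expand : ∀ N → 5 * N * N + 3 * N ≡ 2 * N * N + 2 * suc N * N + suc N * N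
  expand = solve-∀

≤[5/2]^⇒≤e^ : ∀ {x y} r → 2 ^ r * x ≤ 5 ^ r * y → x ≤e^ r · y
≤[5/2]^⇒≤e^ {x} {y} r 2ʳx≤5ʳy N 1≤N = *-cancelˡ-≤ (2 ^ r) {{m^n≢0 2 r}} (begin
  2 ^ r * (x * N ^ ((N + 1) * r))         ≡⟨ cong (λ z → 2 ^ r * (x * z)) (^-*-assoc N (N + 1) r) ⟨
  2 ^ r * (x * A ^ r)                     ≡⟨ *-assoc (2 ^ r) x _ ⟨
  2 ^ r * x * A ^ r                       ≤⟨ *-monoˡ-≤ (A ^ r) 2ʳx≤5ʳy ⟩
  5 ^ r * y * A ^ r                       ≡⟨ *-CS.xy∙z≈y∙xz (5 ^ r) y _ ⟩
  y * (5 ^ r * A ^ r)                     ≡⟨ cong (y *_) (^-distribʳ-* 5 A r) ⟨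
  y * (5 * A) ^ r                         ≤⟨ *-monoʳ-≤ y (^-monoˡ-≤ r (5/2≤[1+1/N]^[N+1] N 1≤N)) ⟩
  y * (2 * B) ^ r                         ≡⟨ cong (y *_) (^-distribʳ-* 2 B r) ⟩
  y * (2 ^ r * B ^ r)                     ≡⟨ *-CS.x∙yz≈y∙xz y (2 ^ r) _ ⟩
  2 ^ r * (y * B ^ r)                     ≡⟨ cong (λ z → 2 ^ r * (y * z)) (^-*-assoc (N + 1) (N + 1) r) ⟩
  2 ^ r * (y * (N + 1) ^ ((N + 1) * r))   ≡⟨ cong (2 ^ r *_) (*-comm y _) ⟩
  2 ^ r * ((N + 1) ^ ((N + 1) * r) * y)   ∎)
  where
  open ≤-Reasoning
  A = N ^ (N + 1)
  B = (N + 1) ^ (N + 1)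

≤-maxList : ∀ {x xs} → x ∈ xs → x ≤ maxList xs
≤-maxList (here refl) = m≤m⊔n _ _
≤-maxList (there x∈) = ≤-trans (≤-maxList x∈) (m≤n⊔m _ _)

*-maxList-≤ : ∀ a {M} xs → All (λ x → a * x ≤ M) xs → a * maxList xs ≤ M
*-maxList-≤ a []       []          = ≤-trans (≤-reflexive (*-zeroʳ a)) z≤n
*-maxList-≤ a (x ∷ xs) (ax≤ ∷ ≤s) =
  ≤-trans (≤-reflexive (*-distribˡ-⊔ a x (maxList xs))) (⊔-lub ax≤ (*-maxList-≤ a xs ≤s))

HasLargePart : ℕ → List ℕ → Set
HasLargePart b T = ∃₂ λ q R → 2 + b ≤ q × T ↭ q ∷ R

HasLargePart-∷ : ∀ {b T} q → HasLargePart b T → HasLargePart b (q ∷ T)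
HasLargePart-∷ q (q′ , R , le , T↭) = q′ , q ∷ R , le , ↭-trans (↭-prep q T↭) (↭-swap q q′ ↭-refl)

drop-small-part : ∀ m {b q L S} → q ≤ b → m + (b + L) ≤ q + S → m + L ≤ S
drop-small-part m {b} {q} {L} {S} q≤b le = +-cancelˡ-≤ b (m + L) S (begin
  b + (m + L)   ≡⟨ +-CS.x∙yz≈y∙xz b m L ⟩
  m + (b + L)   ≤⟨ le ⟩
  q + S         ≤⟨ +-monoˡ-≤ S q≤b ⟩
  b + S         ∎)
  where open ≤-Reasoning

largePart⊎replicate : ∀ b m T → m + length T * b ≤ sum T →
  HasLargePart b T ⊎ ∃ λ R → T ↭ replicate m (suc b) ++ R
largePart⊎replicate b zero    T       _ = inj₂ (T , ↭-refl)
largePart⊎replicate b (suc m) (q ∷ T) le with <-cmp q (suc b)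
... | tri< q≤b _ _ = Sum.map (HasLargePart-∷ q)
  (λ (R , T↭) → q ∷ R , ↭-trans (↭-prep q T↭) (↭-sym (shift q (replicate (suc m) (suc b)) R)))
  (largePart⊎replicate b (suc m) T (drop-small-part (suc m) (s≤s⁻¹ q≤b) le))
... | tri≈ _ refl _ = Sum.map (HasLargePart-∷ q) (λ (R , T↭) → R , ↭-prep q T↭)
  (largePart⊎replicate b m T (drop-small-part m ≤-refl (s≤s⁻¹ le)))
... | tri> _ _ b+1<q = inj₁ (q , T , b+1<q , ↭-refl)

IsComposition : ℕ → List ℕ → Set
IsComposition n Q = All (1 ≤_) Q × sum Q ≡ n

maxProduct : ℕ → ℕ → ℕ
maxProduct n k = maxList (map product (compositions n k))

withFirstPart : ℕ → ℕ → ℕ → List (List ℕ)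
withFirstPart n k q = map (q ∷_) (compositions (n ∸ q) k)

-- The defining clause of compositions n (suc k) only fires once n is a constructor.
compositions-suc : ∀ n k → compositions n (suc k) ≡ concatMap (withFirstPart n k) (map suc (upTo n))
compositions-suc zero    k = refl
compositions-suc (suc n) k = refl

compositions-sound : ∀ {n k Q} → Q ∈ compositions n k → IsComposition n Q × length Q ≡ k
compositions-sound {zero} {zero} (here refl) = ([] , refl) , refl
compositions-sound {n} {suc k} Q∈
  with q , q∈ , Q∈q∷ ← find (∈-concatMap⁻ (withFirstPart n k) {xs = map suc (upTo n)}
                               (subst (_ ∈_) (compositions-suc n k) Q∈))
  with i , i∈ , refl ← ∈-map⁻ suc q∈
  with Q′ , Q′∈ , refl ← ∈-map⁻ (suc i ∷_) Q∈q∷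
  with (pos , sum≡) , length≡ ← compositions-sound Q′∈
  = (s≤s z≤n ∷ pos , trans (cong (suc i +_) sum≡) (m+[n∸m]≡n (∈-upTo⁻ i∈))) , cong suc length≡

compositions-complete : ∀ {n Q} → IsComposition n Q → Q ∈ compositions n (length Q)
compositions-complete ([] , refl) = here refl
compositions-complete {Q = suc i ∷ Q′} (s≤s z≤n ∷ pos , refl) =
  subst (suc i ∷ Q′ ∈_) (sym (compositions-suc n (length Q′)))
    (∈-concatMap⁺ (withFirstPart n (length Q′)) {xs = map suc (upTo n)}
      (lose (∈-map⁺ suc (∈-upTo⁺ i<n)) (∈-map⁺ (suc i ∷_) Q′∈)))
  where
  n = suc i + sum Q′
  i<n : i < n
  i<n = s≤s (m≤m+n i (sum Q′))
  Q′∈ : Q′ ∈ compositions (n ∸ suc i) (length Q′)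
  Q′∈ = subst (λ m → Q′ ∈ compositions m (length Q′)) (sym (m+n∸m≡n (suc i) (sum Q′)))
          (compositions-complete (pos , refl))

product≤maxProduct : ∀ {n Q} → IsComposition n Q → product Q ≤ maxProduct n (length Q)
product≤maxProduct comp = ≤-maxList (∈-map⁺ product (compositions-complete comp))

*-maxProduct-≤ : ∀ a {M n k} → (∀ {Q} → IsComposition n Q → length Q ≡ k → a * product Q ≤ M) →
  a * maxProduct n k ≤ M
*-maxProduct-≤ a bound = *-maxList-≤ a _ (AllP.map⁺ (All.tabulate λ Q∈ →
  let comp , length≡ = compositions-sound Q∈ in bound comp length≡))

IsComposition-resp-↭ : ∀ {n Q Q′} → Q ↭ Q′ → IsComposition n Q → IsComposition n Q′
IsComposition-resp-↭ Q↭ (pos , sum≡) = All-resp-↭ Q↭ pos , trans (sym (sum-↭ Q↭)) sum≡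

exchange : ∀ {n} A B {R} → IsComposition n (A ++ R) → All (1 ≤_) B → sum B ≡ sum A →
  IsComposition n (B ++ R)
exchange {n} A B {R} (pos , sum≡) posB sumB≡sumA = AllP.++⁺ posB (AllP.++⁻ʳ A pos) , (begin
  sum (B ++ R)    ≡⟨ sum-++ B R ⟩
  sum B + sum R   ≡⟨ cong (_+ sum R) sumB≡sumA ⟩
  sum A + sum R   ≡⟨ sum-++ A R ⟨
  sum (A ++ R)    ≡⟨ sum≡ ⟩
  n               ∎)
  where open ≡-Reasoning

trade-≤ : ∀ {a b n Q R} A B → IsComposition n Q → Q ↭ A ++ R →
  All (1 ≤_) B → sum B ≡ sum A → length B ≡ suc (length A) →
  a * product A ≤ b * product B → a * product Q ≤ b * maxProduct n (suc (length Q))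
trade-≤ {a} {b} {n} {Q} {R} A B comp Q↭ posB sumB≡sumA lengthB≡ ab≤ = begin
  a * product Q                       ≡⟨ cong (a *_) (trans (product-↭ Q↭) (product-++ A R)) ⟩
  a * (product A * product R)         ≡⟨ *-assoc a _ _ ⟨
  a * product A * product R           ≤⟨ *-monoˡ-≤ (product R) ab≤ ⟩
  b * product B * product R           ≡⟨ *-assoc b _ _ ⟩
  b * (product B * product R)         ≡⟨ cong (b *_) (product-++ B R) ⟨
  b * product (B ++ R)                ≤⟨ *-monoʳ-≤ b (product≤maxProduct comp′) ⟩
  b * maxProduct n (length (B ++ R))  ≡⟨ cong (λ k → b * maxProduct n k) length≡ ⟩
  b * maxProduct n (suc (length Q))   ∎
  where
  open ≤-Reasoning
  comp′ : IsComposition n (B ++ R)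
  comp′ = exchange A B (IsComposition-resp-↭ Q↭ comp) posB sumB≡sumA
  length≡ : length (B ++ R) ≡ suc (length Q)
  length≡ = begin-equality
    length (B ++ R)          ≡⟨ length-++ B ⟩
    length B + length R      ≡⟨ cong (_+ length R) lengthB≡ ⟩
    suc (length A + length R) ≡⟨ cong suc (length-++ A) ⟨
    suc (length (A ++ R))    ≡⟨ cong suc (↭-length Q↭) ⟨
    suc (length Q)           ∎

split-≤ : ∀ {a b n Q R} x y → 1 ≤ x → 1 ≤ y → IsComposition n Q → Q ↭ x + y ∷ R →
  a * (x + y) ≤ b * (x * y) → a * product Q ≤ b * maxProduct n (suc (length Q))
split-≤ {a} {b} x y 1≤x 1≤y comp Q↭ ab≤ =
  trade-≤ {a} {b} (x + y ∷ []) (x ∷ y ∷ []) comp Q↭ (1≤x ∷ 1≤y ∷ []) (sym (+-assoc x y 0)) refl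
    (subst₂ _≤_ (cong (a *_) (sym (*-identityʳ (x + y))))
                (cong (λ z → b * (x * z)) (sym (*-identityʳ y))) ab≤)

refine-≤-2 : ∀ {n Q} → IsComposition n Q → suc (length Q) ≤ n →
  1 * product Q ≤ 2 * maxProduct n (suc (length Q))
refine-≤-2 {n} {Q} comp@(_ , refl) k<n
  with largePart⊎replicate 1 1 Q (subst (λ L → suc L ≤ n) (sym (*-identityʳ (length Q))) k<n)
... | inj₁ (suc (suc (suc m)) , R , s≤s (s≤s (s≤s _)) , Q↭) =
  split-≤ {1} {2} 1 (2 + m) ≤-refl z<s comp Q↭ (≤″⇒≤ (suc m , identity m))
  where
  identity : ∀ m → 1 * (3 + m) + suc m ≡ 2 * (1 * (2 + m))
  identity = solve-∀
... | inj₂ (R , Q↭) = split-≤ {1} {2} 1 1 ≤-refl ≤-refl comp Q↭ (≤″⇒≤ (0 , refl))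

refine-≤-5/6 : ∀ {n Q} → IsComposition n Q → 3 + length Q * 3 ≤ n →
  6 * product Q ≤ 5 * maxProduct n (suc (length Q))
refine-≤-5/6 {n} {Q} comp@(_ , refl) le with largePart⊎replicate 3 3 Q le
... | inj₁ (suc (suc (suc (suc (suc m)))) , R , s≤s (s≤s (s≤s (s≤s (s≤s _)))) , Q↭) =
  split-≤ {6} {5} 2 (3 + m) z<s z<s comp Q↭ (≤″⇒≤ (4 * m , identity m))
  where
  identity : ∀ m → 6 * (5 + m) + 4 * m ≡ 5 * (2 * (3 + m))
  identity = solve-∀
... | inj₂ (R , Q↭) =
  trade-≤ {6} {5} (replicate 3 4) (replicate 4 3) comp Q↭ (AllP.replicate⁺ 4 z<s) refl refl
    (≤″⇒≤ (21 , refl))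

refine-≤-9/8 : ∀ {n Q} → IsComposition n Q → 2 + length Q * 2 ≤ n →
  8 * product Q ≤ 9 * maxProduct n (suc (length Q))
refine-≤-9/8 {n} {Q} comp@(_ , refl) le with largePart⊎replicate 2 2 Q le
... | inj₁ (suc (suc (suc (suc m))) , R , s≤s (s≤s (s≤s (s≤s _))) , Q↭) =
  split-≤ {8} {9} 2 (2 + m) z<s z<s comp Q↭ (≤″⇒≤ (4 + 10 * m , identity m))
  where
  identity : ∀ m → 8 * (4 + m) + (4 + 10 * m) ≡ 9 * (2 * (2 + m))
  identity = solve-∀
... | inj₂ (R , Q↭) =
  trade-≤ {8} {9} (replicate 2 3) (replicate 3 2) comp Q↭ (AllP.replicate⁺ 3 z<s) refl refl ≤-refl

merge-≤ : ∀ {n x y R} → IsComposition n (x ∷ y ∷ R) →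
  1 * product (x ∷ y ∷ R) ≤ n * maxProduct n (suc (length R))
merge-≤ {n} {x} {y} {R} comp@(1≤x ∷ _ , sum≡) = begin
  1 * (x * (y * product R))   ≡⟨ *-identityˡ _ ⟩
  x * (y * product R)         ≤⟨ *-mono-≤ x≤n (*-monoˡ-≤ (product R) (m≤n+m y x)) ⟩
  n * ((x + y) * product R)   ≤⟨ *-monoʳ-≤ n (product≤maxProduct merged) ⟩
  n * maxProduct n (suc (length R)) ∎
  where
  open ≤-Reasoning
  x≤n : x ≤ n
  x≤n = subst (x ≤_) sum≡ (m≤m+n x _)
  merged : IsComposition n (x + y ∷ R)
  merged = exchange (x ∷ y ∷ []) (x + y ∷ []) comp (≤-trans 1≤x (m≤m+n x y) ∷ []) (+-assoc x y 0)

*-maxProduct-step : ∀ {a b n k} (P : ℕ → Set) →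
  (∀ {Q} → IsComposition n Q → P (length Q) → a * product Q ≤ b * maxProduct n (suc (length Q))) →
  P k → a * maxProduct n k ≤ b * maxProduct n (suc k)
*-maxProduct-step {a} {b} {n} P local Pk = *-maxProduct-≤ a λ comp length≡ →
  subst (λ j → a * _ ≤ b * maxProduct n (suc j)) length≡ (local comp (subst P (sym length≡) Pk))

maxProduct-merge-step : ∀ {n k} → 1 * maxProduct n (suc (suc k)) ≤ n * maxProduct n (suc k)
maxProduct-merge-step {n} = *-maxProduct-≤ 1 merge
  where
  merge : ∀ {k Q} → IsComposition n Q → length Q ≡ suc (suc k) →
    1 * product Q ≤ n * maxProduct n (suc k)
  merge {Q = x ∷ y ∷ R} comp length≡ =
    subst (λ j → 1 * product (x ∷ y ∷ R) ≤ n * maxProduct n j) (suc-injective length≡) (merge-≤ comp)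

maxProduct-ratio≤2^ : ∀ {n} r {K} → r + K ≤ n → maxProduct n K ≤ 2 ^ r * maxProduct n (r + K)
maxProduct-ratio≤2^ {n} r {K} r+K≤n =
  subst (_≤ 2 ^ r * maxProduct n (r + K)) (1^r*x≡x r (maxProduct n K))
    (geometric-growth (maxProduct n) (_≤ n) (λ {j} → ≤-trans (n≤1+n j))
      (*-maxProduct-step {1} {2} (λ L → suc L ≤ n) refine-≤-2) r r+K≤n)

maxProduct-ratio≤[5/6]^ : ∀ {n} r {K} → (r + K) * 3 ≤ n →
  6 ^ r * maxProduct n K ≤ 5 ^ r * maxProduct n (r + K)
maxProduct-ratio≤[5/6]^ {n} r = geometric-growth (maxProduct n) (λ j → j * 3 ≤ n) (m+n≤o⇒n≤o 3)
  (*-maxProduct-step {6} {5} (λ L → 3 + L * 3 ≤ n) refine-≤-5/6) r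

maxProduct-ratio≤[e/3]^ : ∀ {n} r {K} → (r + K) * 3 ≤ n →
  (maxProduct n K * 3 ^ r) ≤e^ r · maxProduct n (r + K)
maxProduct-ratio≤[e/3]^ {n} r {K} [r+K]*3≤n = ≤[5/2]^⇒≤e^ r (begin
  2 ^ r * (maxProduct n K * 3 ^ r)  ≡⟨ *-CS.x∙yz≈xz∙y (2 ^ r) (maxProduct n K) (3 ^ r) ⟩
  2 ^ r * 3 ^ r * maxProduct n K    ≡⟨ cong (_* maxProduct n K) (^-distribʳ-* 2 3 r) ⟨
  6 ^ r * maxProduct n K            ≤⟨ maxProduct-ratio≤[5/6]^ r [r+K]*3≤n ⟩
  5 ^ r * maxProduct n (r + K)      ∎)
  where open ≤-Reasoning

maxProduct-ratio≤[9/8]^ : ∀ {n} r {K} → (r + K) * 2 ≤ n →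
  maxProduct n K * 8 ^ r ≤ 9 ^ r * maxProduct n (r + K)
maxProduct-ratio≤[9/8]^ {n} r {K} =
  subst (_≤ 9 ^ r * maxProduct n (r + K)) (*-comm (8 ^ r) (maxProduct n K)) ∘
    geometric-growth (maxProduct n) (λ j → j * 2 ≤ n) (m+n≤o⇒n≤o 2)
      (*-maxProduct-step {8} {9} (λ L → 2 + L * 2 ≤ n) refine-≤-9/8) r

maxProduct-ratio≥1/n^ : ∀ {n} r {K} → 1 ≤ K → maxProduct n (r + K) ≤ n ^ r * maxProduct n K
maxProduct-ratio≥1/n^ {n} r {K} 1≤K =
  subst (_≤ n ^ r * maxProduct n K) (1^r*x≡x r (maxProduct n (r + K)))
    (geometric-decay (maxProduct n) (1 ≤_) (λ {j} 1≤j → ≤-trans 1≤j (n≤1+n j)) merge-step r 1≤K)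
  where
  merge-step : ∀ {j} → 1 ≤ j → 1 * maxProduct n (suc j) ≤ n * maxProduct n j
  merge-step {suc j} _ = maxProduct-merge-step {n}

n∸t≡r+[n∸[t+r]] : ∀ {n} t r → t + r ≤ n → n ∸ t ≡ r + (n ∸ (t + r))
n∸t≡r+[n∸[t+r]] {n} t r t+r≤n = begin
  n ∸ t              ≡⟨ m+[n∸m]≡n (m+n≤o⇒m≤o∸n r (subst (_≤ n) (+-comm t r) t+r≤n)) ⟨
  r + (n ∸ t ∸ r)    ≡⟨ cong (r +_) (∸-+-assoc n t r) ⟩
  r + (n ∸ (t + r))  ∎
  where open ≡-Reasoning

lemma9 : ∀ (n t r : ℕ) → t + r + 2 ≤ n →
    (c n (t + r) ≤ 2 ^ r * c n t)
    × (2 * n ≤ 3 * t → (c n (t + r) * 3 ^ r) ≤e^ r · c n t)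
    × (n ≤ 2 * t → 3 * t < 2 * n → c n (t + r) * 8 ^ r ≤ 9 ^ r * c n t)
    × (c n t ≤ n ^ r * c n (t + r))
lemma9 n t r t+r+2≤n = part-i , part-ii , part-iii , part-iv
  where
  K = n ∸ (t + r)
  n∸t≡r+K : n ∸ t ≡ r + K
  n∸t≡r+K = n∸t≡r+[n∸[t+r]] t r (m+n≤o⇒m≤o (t + r) t+r+2≤n)
  [r+K]*[1+e]≤n : ∀ e → e * n ≤ suc e * t → (r + K) * suc e ≤ n
  [r+K]*[1+e]≤n e = subst (λ u → u * suc e ≤ n) n∸t≡r+K ∘ [n∸t]*[1+e]≤n n t e
  c[n,t]≡ : c n t ≡ maxProduct n (r + K)
  c[n,t]≡ = cong (maxProduct n) n∸t≡r+K

  part-i : c n (t + r) ≤ 2 ^ r * c n t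
  part-i rewrite c[n,t]≡ = maxProduct-ratio≤2^ r (subst (_≤ n) n∸t≡r+K (m∸n≤m n t))

  part-ii : 2 * n ≤ 3 * t → (c n (t + r) * 3 ^ r) ≤e^ r · c n t
  part-ii 2n≤3t rewrite c[n,t]≡ = maxProduct-ratio≤[e/3]^ r ([r+K]*[1+e]≤n 2 2n≤3t)

  -- The bound holds for every t ≥ n/2; the hypothesis 3t < 2n only separates this case from (ii).
  part-iii : n ≤ 2 * t → 3 * t < 2 * n → c n (t + r) * 8 ^ r ≤ 9 ^ r * c n t
  part-iii n≤2t _ rewrite c[n,t]≡ =
    maxProduct-ratio≤[9/8]^ r ([r+K]*[1+e]≤n 1 (subst (_≤ 2 * t) (sym (*-identityˡ n)) n≤2t))

  part-iv : c n t ≤ n ^ r * c n (t + r)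
  part-iv rewrite c[n,t]≡ =
    maxProduct-ratio≥1/n^ r (≤-trans z<s (m+n≤o⇒m≤o∸n 2 (subst (_≤ n) (+-comm (t + r) 2) t+r+2≤n)))
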